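{- Let $n$ and $k=k(n)\le n$ be positive integers. There exists a set $D=\{p_1,\dots,p_n\}$ of $n$ points in $\mathbb{R}^d$ with $d=O(k\log n)$ such that for every $I\subseteq\{1,\dots,n\}$ with $|I|=k$ there exists a query point $q_I\in\mathbb{R}^d$ for which the set $I'=\{i : \|p_i-q_I\|_\infty\le 1/2\}$ satisfies $I\subseteq I'$ and $|I'|\le 3k/2$.
   Context: $\|\cdot\|_\infty$ denotes the maximum norm on $\mathbb{R}^d$. -}

module Defs where

open import Data.Nat using (ℕ; zero; suc)
open import Data.Fin using (Fin; zero; suc)
open import Data.Rational using (ℚ; 0ℚ; _-_; _⊔_; ∣_∣)

Point : ℕ → Set
Point d = Fin d → ℚ

‖_‖∞ : ∀ {d} → Point d → ℚ
‖_‖∞ {zero}  x = 0ℚ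
‖_‖∞ {suc d} x = ∣ x zero ∣ ⊔ ‖ (λ j → x (suc j)) ‖∞

_-ᵥ_ : ∀ {d} → Point d → Point d → Point d
(x -ᵥ y) j = x j - y j

module Submission where

-- Colour the n points in m = 3⌈log₂ n⌉ rows, each with a = 2k colours.  Point x becomes
-- the concatenation of the one-hot vectors of its m colours, and the query for I puts ½ on
-- every (row, colour) used by a member of I.  Then ‖p_x − q_I‖∞ ≤ ½ exactly when, in every
-- row, x shares its colour with some member of I; call such x covered by I.  Let s = ⌊k/2⌋+1.
-- If some k-set I covers k + s points, pick s covered points X outside I: the colouring is
-- then determined by I, X, and per row by the colours off X together with, for each x ∈ X,
-- the position in I of a point of the same colour.  That gives at most
-- n^k · n^s · (k^s a^(n−s))^m such colourings, fewer than all a^(nm) of them because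
-- n^(k+s) < 2^(sm) (as k + s < 3s).  So some colouring makes |I′| ≤ k + ⌊k/2⌋ ≤ 3k/2 for
-- every k-set I.

open import Defs
open import Data.Nat using (ℕ; _*_; _≤_; _<_)
open import Data.Nat.Logarithm using (⌈log₂_⌉)
open import Data.Fin using (Fin)
open import Data.Fin.Subset using (Subset; _∈_; _⊆_; ∣_∣)
open import Data.Product using (Σ; _×_; ∃-syntax)
open import Data.Rational using (½)
open import Function.Bundles using (_⇔_)
open import Relation.Binary.PropositionalEquality using (_≡_)
import Data.Rational as Q

open import Data.Bool using (if_then_else_)
open import Data.Empty using (⊥-elim)
open import Data.Fin using (zero; suc; fromℕ<; remQuot; combine)
import Data.Fin as Fin
open import Data.Fin.Properties using (any?; all?; pigeonhole; <⇒≢; remQuot-combine)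
open import Data.Fin.Subset using (Side; inside; outside; ⊥; ⊤; ∁; _─_; _∉_)
open import Data.Fin.Subset.Properties
  using (_∈?_; anySubset?; drop-there; ⊥⊆; ∈⊤; ∣⊥∣≡0; ∣⊤∣≡n; ∣∁p∣≡n∸∣p∣; p─q⊆p)
open import Data.List using (List; []; _∷_; length; map; _++_; concatMap; cartesianProduct;
  cartesianProductWith; allFin)
import Data.List as List
open import Data.List.Properties using (length-++; length-map; length-tabulate)
open import Data.List.Membership.Propositional using () renaming (_∈_ to _∈ₗ_)
open import Data.List.Membership.Propositional.Properties
  using (∈-lookup; ∈-map⁺; ∈-map⁻; ∈-++⁺ˡ; ∈-++⁺ʳ; ∈-++⁻; ∈-allFin; ∈-concat⁺′;
         ∈-cartesianProduct⁺; ∈-cartesianProductWith⁺)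
open import Data.List.Relation.Binary.Subset.Propositional using () renaming (_⊆_ to _⊆ₗ_)
import Data.List.Relation.Unary.All as All
open import Data.List.Relation.Unary.All using ([])
open import Data.List.Relation.Unary.All.Properties using (¬Any⇒All¬)
import Data.List.Relation.Unary.Any as Any
open import Data.List.Relation.Unary.Any using (here; there; index)
open import Data.List.Relation.Unary.Any.Properties using (lookup-index)
open import Data.List.Relation.Unary.AllPairs using ([]; _∷_)
open import Data.List.Relation.Unary.Unique.Propositional using (Unique)
import Data.List.Relation.Unary.Unique.Propositional.Properties as Unique
open import Data.Nat using (zero; suc; _+_; _^_; _∸_; _≤?_; z≤n; s≤s; ⌊_/2⌋; ⌈_/2⌉;
  NonZero; >-nonZero; >-nonZero⁻¹)
open import Data.Nat.Induction using (<-rec)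
open import Data.Nat.Logarithm using (⌈log₂⌉-mono-≤; ⌈log₂⌈n/2⌉⌉≡⌈log₂n⌉∸1)
open import Data.Nat.Properties
  using (_≟_; ≤-refl; ≤-reflexive; ≤-trans; ≤-pred; ≮⇒≥; ≰⇒>; ≤⇒≯; n≤1+n; m≤n+m; m+[n∸m]≡n;
         +-comm; +-suc; +-identityʳ; +-cancelˡ-≤; +-mono-≤; +-monoˡ-≤; +-monoʳ-≤; *-assoc;
         *-distribʳ-+; *-monoˡ-≤; *-monoʳ-≤; *-monoˡ-<; *-monoʳ-<; ^-distribˡ-+-*; ^-*-assoc;
         ^-monoˡ-≤; ^-monoʳ-<; m^n≢0; suc-pred; ⌊n/2⌋≤⌈n/2⌉; ⌊n/2⌋+⌈n/2⌉≡n; ⌈n/2⌉<n;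
         *-commutativeSemigroup; module ≤-Reasoning)
open import Algebra.Properties.CommutativeSemigroup *-commutativeSemigroup using (interchange; x∙yz≈y∙xz)
open import Data.Nat.Tactic.RingSolver using (solve-∀)
open import Data.Product using (Σ-syntax; _,_; proj₁; proj₂)
open import Data.Rational using (ℚ; 0ℚ; 1ℚ; _-_)
import Data.Rational.Properties as ℚₚ
open import Data.Sum using (_⊎_; inj₁; inj₂; [_,_])
open import Data.Vec using (Vec; []; _∷_; here; there; lookup; replicate; tabulate)
import Data.Vec as Vec
open import Data.Vec.Properties using (∷-injective; lookup-map; lookup-replicate; lookup∘tabulate;
  lookup⇒[]=; []=⇒lookup)
open import Data.Vec.Relation.Binary.Pointwise.Extensional using (ext; Pointwise-≡⇒≡)
open import Function using (_∘_; id; const)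
open import Function.Bundles using (mk⇔; Equivalence)
import Function.Properties.Equivalence as ⇔
open import Level using (Level)
open import Relation.Nullary using (Dec; yes; no; does; ¬?; contradiction)
open import Relation.Nullary.Decidable using (_×-dec_; toWitness; toWitnessFalse; decidable-stable)
open import Relation.Unary using (Pred; Decidable)
open import Relation.Binary.PropositionalEquality
  using (refl; sym; trans; cong; cong₂; subst; subst₂; module ≡-Reasoning)

private variable
  ℓ : Level
  A B C : Set
  n : ℕ

length-cartesianProductWith : (f : A → B → C) (xs : List A) (ys : List B) →
  length (cartesianProductWith f xs ys) ≡ length xs * length ys
length-cartesianProductWith f []       ys = refl
length-cartesianProductWith f (x ∷ xs) ys = begin
  length (map (f x) ys ++ cartesianProductWith f xs ys)
    ≡⟨ length-++ (map (f x) ys) ⟩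
  length (map (f x) ys) + length (cartesianProductWith f xs ys)
    ≡⟨ cong₂ _+_ (length-map (f x) ys) (length-cartesianProductWith f xs ys) ⟩
  length ys + length xs * length ys ∎
  where open ≡-Reasoning

length-concatMap-const : (f : A → List B) {c : ℕ} (xs : List A) →
  (∀ {x} → x ∈ₗ xs → length (f x) ≡ c) → length (concatMap f xs) ≡ length xs * c
length-concatMap-const f []       _   = refl
length-concatMap-const f (x ∷ xs) len = begin
  length (f x ++ concatMap f xs)
    ≡⟨ length-++ (f x) ⟩
  length (f x) + length (concatMap f xs)
    ≡⟨ cong₂ _+_ (len (here refl)) (length-concatMap-const f xs (len ∘ there)) ⟩
  _ + length xs * _ ∎
  where open ≡-Reasoning

length-map-allFin : ∀ {t} (f : Fin t → A) → length (map f (allFin t)) ≡ t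
length-map-allFin f = trans (length-map f (allFin _)) (length-tabulate id)

Unique-lookup-injective : ∀ {xs : List A} → Unique xs → ∀ i j → List.lookup xs i ≡ List.lookup xs j → i ≡ j
Unique-lookup-injective (x∉ ∷ u) zero    zero    _  = refl
Unique-lookup-injective (x∉ ∷ u) zero    (suc j) eq = ⊥-elim (All.lookup x∉ (∈-lookup j) eq)
Unique-lookup-injective (x∉ ∷ u) (suc i) zero    eq = ⊥-elim (All.lookup x∉ (∈-lookup i) (sym eq))
Unique-lookup-injective (x∉ ∷ u) (suc i) (suc j) eq = cong suc (Unique-lookup-injective u i j eq)

Unique-⊆⇒length≤ : ∀ {xs ys : List A} → Unique xs → xs ⊆ₗ ys → length xs ≤ length ys
Unique-⊆⇒length≤ {xs = xs} {ys} u xs⊆ys = ≮⇒≥ λ ys<xs →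
  let i , j , i<j , same = pigeonhole ys<xs (index ∘ xs⊆ys ∘ ∈-lookup) in
  <⇒≢ i<j (Unique-lookup-injective u i j (begin
    List.lookup xs i                            ≡⟨ lookup-index (xs⊆ys (∈-lookup i)) ⟩
    List.lookup ys (index (xs⊆ys (∈-lookup i))) ≡⟨ cong (List.lookup ys) same ⟩
    List.lookup ys (index (xs⊆ys (∈-lookup j))) ≡⟨ lookup-index (xs⊆ys (∈-lookup j)) ⟨
    List.lookup xs j                            ∎))
  where open ≡-Reasoning

choices : Vec (List A) n → List (Vec A n)
choices []         = List.[ [] ]
choices (xs ∷ xss) = cartesianProductWith _∷_ xs (choices xss)

∈-choices : ∀ {xss : Vec (List A) n} {v : Vec A n} → (∀ i → lookup v i ∈ₗ lookup xss i) → v ∈ₗ choices xss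
∈-choices {xss = []}       {[]}    _  = here refl
∈-choices {xss = xs ∷ xss} {x ∷ v} v∈ =
  ∈-cartesianProductWith⁺ _∷_ (v∈ zero) (∈-choices {xss = xss} (v∈ ∘ suc))

Unique-choices : ∀ {xss : Vec (List A) n} → (∀ i → Unique (lookup xss i)) → Unique (choices xss)
Unique-choices {xss = []}       _ = [] ∷ []
Unique-choices {xss = xs ∷ xss} u =
  Unique.cartesianProductWith⁺ _∷_ ∷-injective (u zero) (Unique-choices {xss = xss} (u ∘ suc))

vectors : (n : ℕ) → List A → List (Vec A n)
vectors n xs = choices (replicate n xs)

length-vectors : ∀ n (xs : List A) → length (vectors n xs) ≡ length xs ^ n
length-vectors zero    xs = refl
length-vectors (suc n) xs =
  trans (length-cartesianProductWith _∷_ xs (vectors n xs)) (cong (length xs *_) (length-vectors n xs))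

∈-vectors : ∀ {xs : List A} {v : Vec A n} → (∀ i → lookup v i ∈ₗ xs) → v ∈ₗ vectors n xs
∈-vectors {n = n} {xs = xs} {v} v∈ =
  ∈-choices {xss = replicate n xs} λ i → subst (lookup v i ∈ₗ_) (sym (lookup-replicate i xs)) (v∈ i)

Unique-vectors : ∀ n {xs : List A} → Unique xs → Unique (vectors n xs)
Unique-vectors n {xs} u =
  Unique-choices {xss = replicate n xs} λ i → subst Unique (sym (lookup-replicate i xs)) u

subsetOf : {P : Pred (Fin n) ℓ} → Decidable P → Subset n
subsetOf {zero}  P? = []
subsetOf {suc n} P? = does (P? zero) ∷ subsetOf (P? ∘ suc)

∈-subsetOf : {P : Pred (Fin n) ℓ} (P? : Decidable P) {x : Fin n} → x ∈ subsetOf P? ⇔ P x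
∈-subsetOf P? {zero} with P? zero
... | yes p = mk⇔ (λ _ → p) (λ _ → here)
... | no ¬p = mk⇔ (λ ()) (⊥-elim ∘ ¬p)
∈-subsetOf P? {suc x} = mk⇔ (to ∘ drop-there) (there ∘ from)
  where open Equivalence (∈-subsetOf (P? ∘ suc) {x})

x∉p⇒p[x]≡outside : ∀ {p : Subset n} {x} → x ∉ p → lookup p x ≡ outside
x∉p⇒p[x]≡outside {p = p} {x} x∉p with lookup p x in p[x]
... | inside  = ⊥-elim (x∉p (lookup⇒[]= x p p[x]))
... | outside = refl

x∈p─q⇒x∉q : ∀ {p q : Subset n} {x} → x ∈ p ─ q → x ∉ q
x∈p─q⇒x∉q {p = _ ∷ _} {inside  ∷ _} (there x∈p─q) (there x∈q) = x∈p─q⇒x∉q x∈p─q x∈q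
x∈p─q⇒x∉q {p = _ ∷ _} {outside ∷ _} (there x∈p─q) (there x∈q) = x∈p─q⇒x∉q x∈p─q x∈q

∣p∣≤∣p─q∣+∣q∣ : (p q : Subset n) → ∣ p ∣ ≤ ∣ p ─ q ∣ + ∣ q ∣
∣p∣≤∣p─q∣+∣q∣ []            []            = z≤n
∣p∣≤∣p─q∣+∣q∣ (inside  ∷ p) (inside  ∷ q) =
  subst (suc ∣ p ∣ ≤_) (sym (+-suc ∣ p ─ q ∣ ∣ q ∣)) (s≤s (∣p∣≤∣p─q∣+∣q∣ p q))
∣p∣≤∣p─q∣+∣q∣ (inside  ∷ p) (outside ∷ q) = s≤s (∣p∣≤∣p─q∣+∣q∣ p q)
∣p∣≤∣p─q∣+∣q∣ (outside ∷ p) (inside  ∷ q) = ≤-trans (∣p∣≤∣p─q∣+∣q∣ p q) (+-monoʳ-≤ ∣ p ─ q ∣ (n≤1+n _))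
∣p∣≤∣p─q∣+∣q∣ (outside ∷ p) (outside ∷ q) = ∣p∣≤∣p─q∣+∣q∣ p q

s≤∣p─q∣ : ∀ {k s} (p q : Subset n) → ∣ q ∣ ≡ k → k + s ≤ ∣ p ∣ → s ≤ ∣ p ─ q ∣
s≤∣p─q∣ {k = k} {s} p q ∣q∣≡k k+s≤∣p∣ = +-cancelˡ-≤ k s ∣ p ─ q ∣ (begin
  k + s             ≤⟨ k+s≤∣p∣ ⟩
  ∣ p ∣             ≤⟨ ∣p∣≤∣p─q∣+∣q∣ p q ⟩
  ∣ p ─ q ∣ + ∣ q ∣ ≡⟨ cong (∣ p ─ q ∣ +_) ∣q∣≡k ⟩
  ∣ p ─ q ∣ + k     ≡⟨ +-comm ∣ p ─ q ∣ k ⟩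
  k + ∣ p ─ q ∣     ∎)
  where open ≤-Reasoning

⊆-ofSize : ∀ {s} (p : Subset n) → s ≤ ∣ p ∣ → ∃[ q ] (q ⊆ p × ∣ q ∣ ≡ s)
⊆-ofSize {n} {zero} _ _ = ⊥ , ⊥⊆ , ∣⊥∣≡0 n
⊆-ofSize {s = suc s} (inside ∷ p) (s≤s s≤∣p∣) with q , q⊆p , ∣q∣≡s ← ⊆-ofSize p s≤∣p∣ =
  inside ∷ q , (λ { here → here ; (there x∈q) → there (q⊆p x∈q) }) , cong suc ∣q∣≡s
⊆-ofSize {s = suc s} (outside ∷ p) s≤∣p∣ with q , q⊆p , ∣q∣≡s ← ⊆-ofSize p s≤∣p∣ =
  outside ∷ q , (λ { (there x∈q) → there (q⊆p x∈q) }) , ∣q∣≡s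

elements : (p : Subset n) → Vec (Fin n) ∣ p ∣
elements []            = []
elements (inside ∷ p)  = zero ∷ Vec.map suc (elements p)
elements (outside ∷ p) = Vec.map suc (elements p)

∈-elements : ∀ {p : Subset n} {x} → x ∈ p → ∃[ j ] lookup (elements p) j ≡ x
∈-elements here = zero , refl
∈-elements {p = inside ∷ p} (there x∈p) with j , refl ← ∈-elements x∈p =
  suc j , lookup-map j suc (elements p)
∈-elements {p = outside ∷ p} (there x∈p) with j , refl ← ∈-elements x∈p =
  j , lookup-map j suc (elements p)

enumeration : ∀ {k} (p : Subset n) → ∣ p ∣ ≡ k →
  Σ[ is ∈ Vec (Fin n) k ] (∀ {x} → x ∈ p → ∃[ j ] lookup is j ≡ x)
enumeration p refl = elements p , ∈-elements

subsetsOfSize : (n s : ℕ) → List (Subset n)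
subsetsOfSize zero    zero    = List.[ [] ]
subsetsOfSize zero    (suc s) = []
subsetsOfSize (suc n) zero    = map (outside ∷_) (subsetsOfSize n zero)
subsetsOfSize (suc n) (suc s) =
  map (inside ∷_) (subsetsOfSize n s) ++ map (outside ∷_) (subsetsOfSize n (suc s))

∈-subsetsOfSize : (p : Subset n) → p ∈ₗ subsetsOfSize n ∣ p ∣
∈-subsetsOfSize []           = here refl
∈-subsetsOfSize (inside ∷ p) = ∈-++⁺ˡ (∈-map⁺ (inside ∷_) (∈-subsetsOfSize p))
∈-subsetsOfSize {suc n} (outside ∷ p) with ∣ p ∣ | ∈-subsetsOfSize p
... | zero  | p∈ = ∈-map⁺ (outside ∷_) p∈
... | suc s | p∈ = ∈-++⁺ʳ (map (inside ∷_) (subsetsOfSize n s)) (∈-map⁺ (outside ∷_) p∈)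

∈-subsetsOfSize⁻ : ∀ {s} {p : Subset n} → p ∈ₗ subsetsOfSize n s → ∣ p ∣ ≡ s
∈-subsetsOfSize⁻ {zero}  {zero}  (here refl) = refl
∈-subsetsOfSize⁻ {suc n} {zero}  p∈ with q , q∈ , refl ← ∈-map⁻ (outside ∷_) p∈ = ∈-subsetsOfSize⁻ q∈
∈-subsetsOfSize⁻ {suc n} {suc s} p∈ with ∈-++⁻ (map (inside ∷_) (subsetsOfSize n s)) p∈
... | inj₁ p∈ˡ with q , q∈ , refl ← ∈-map⁻ (inside ∷_) p∈ˡ  = cong suc (∈-subsetsOfSize⁻ q∈)
... | inj₂ p∈ʳ with q , q∈ , refl ← ∈-map⁻ (outside ∷_) p∈ʳ = ∈-subsetsOfSize⁻ q∈

length-subsetsOfSize : ∀ n s → length (subsetsOfSize n s) ≤ n ^ s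
length-subsetsOfSize zero    zero    = ≤-refl
length-subsetsOfSize zero    (suc s) = z≤n
length-subsetsOfSize (suc n) zero    =
  ≤-trans (≤-reflexive (length-map (outside ∷_) (subsetsOfSize n zero))) (length-subsetsOfSize n zero)
length-subsetsOfSize (suc n) (suc s) = begin
  length (map (inside ∷_) (subsetsOfSize n s) ++ map (outside ∷_) (subsetsOfSize n (suc s)))
    ≡⟨ length-++ (map (inside ∷_) (subsetsOfSize n s)) ⟩
  length (map (inside ∷_) (subsetsOfSize n s)) + length (map (outside ∷_) (subsetsOfSize n (suc s)))
    ≡⟨ cong₂ _+_ (length-map (inside ∷_) (subsetsOfSize n s))
                 (length-map (outside ∷_) (subsetsOfSize n (suc s))) ⟩
  length (subsetsOfSize n s) + length (subsetsOfSize n (suc s))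
    ≤⟨ +-mono-≤ (length-subsetsOfSize n s) (length-subsetsOfSize n (suc s)) ⟩
  n ^ s + n * n ^ s
    ≤⟨ +-mono-≤ (^-monoˡ-≤ s (n≤1+n n)) (*-monoʳ-≤ n (^-monoˡ-≤ s (n≤1+n n))) ⟩
  suc n ^ s + n * suc n ^ s ∎
  where open ≤-Reasoning

[m*n]^o≡m^o*n^o : ∀ m n o → (m * n) ^ o ≡ m ^ o * n ^ o
[m*n]^o≡m^o*n^o m n zero    = refl
[m*n]^o≡m^o*n^o m n (suc o) =
  trans (cong (m * n *_) ([m*n]^o≡m^o*n^o m n o)) (interchange m n (m ^ o) (n ^ o))

⌊k/2⌋+⌊k/2⌋≤k : ∀ k → ⌊ k /2⌋ + ⌊ k /2⌋ ≤ k
⌊k/2⌋+⌊k/2⌋≤k zero          = z≤n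
⌊k/2⌋+⌊k/2⌋≤k (suc zero)    = z≤n
⌊k/2⌋+⌊k/2⌋≤k (suc (suc k)) =
  s≤s (subst (_≤ suc k) (sym (+-suc ⌊ k /2⌋ ⌊ k /2⌋)) (s≤s (⌊k/2⌋+⌊k/2⌋≤k k)))

k≤1+⌊k/2⌋+⌊k/2⌋ : ∀ k → k ≤ suc (⌊ k /2⌋ + ⌊ k /2⌋)
k≤1+⌊k/2⌋+⌊k/2⌋ zero          = z≤n
k≤1+⌊k/2⌋+⌊k/2⌋ (suc zero)    = s≤s z≤n
k≤1+⌊k/2⌋+⌊k/2⌋ (suc (suc k)) =
  s≤s (subst (suc k ≤_) (cong suc (sym (+-suc ⌊ k /2⌋ ⌊ k /2⌋))) (s≤s (k≤1+⌊k/2⌋+⌊k/2⌋ k)))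

x≤k+⌊k/2⌋⇒2x≤3k : ∀ k {x} → x ≤ k + ⌊ k /2⌋ → 2 * x ≤ 3 * k
x≤k+⌊k/2⌋⇒2x≤3k k {x} x≤ = begin
  2 * x                       ≤⟨ *-monoʳ-≤ 2 x≤ ⟩
  2 * (k + ⌊ k /2⌋)           ≡⟨ double k ⌊ k /2⌋ ⟩
  k + k + (⌊ k /2⌋ + ⌊ k /2⌋) ≤⟨ +-monoʳ-≤ (k + k) (⌊k/2⌋+⌊k/2⌋≤k k) ⟩
  k + k + k                   ≡⟨ triple k ⟩
  3 * k                       ∎
  where
  open ≤-Reasoning
  double : ∀ k t → 2 * (k + t) ≡ k + k + (t + t)
  double = solve-∀
  triple : ∀ k → k + k + k ≡ 3 * k
  triple = solve-∀

0<⌈log₂n⌉ : 2 ≤ n → 0 < ⌈log₂ n ⌉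
0<⌈log₂n⌉ {n} = ⌈log₂⌉-mono-≤ {2} {n}

n≤2^⌈log₂n⌉ : ∀ n → n ≤ 2 ^ ⌈log₂ n ⌉
n≤2^⌈log₂n⌉ = <-rec _ bound
  where
  bound : ∀ n → (∀ {m} → m < n → m ≤ 2 ^ ⌈log₂ m ⌉) → n ≤ 2 ^ ⌈log₂ n ⌉
  bound zero             _   = z≤n
  bound (suc zero)       _   = s≤s z≤n
  bound n@(suc (suc n′)) rec = begin
    n                       ≤⟨ n≤2⌈n/2⌉ ⟩
    2 * ⌈ n /2⌉             ≤⟨ *-monoʳ-≤ 2 (rec {⌈ n /2⌉} (⌈n/2⌉<n n′)) ⟩
    2 * 2 ^ ⌈log₂ ⌈ n /2⌉ ⌉ ≡⟨ cong (λ e → 2 ^ suc e) (⌈log₂⌈n/2⌉⌉≡⌈log₂n⌉∸1 n) ⟩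
    2 ^ suc (⌈log₂ n ⌉ ∸ 1) ≡⟨ cong (2 ^_) (suc-pred ⌈log₂ n ⌉ {{>-nonZero (0<⌈log₂n⌉ 2≤n)}}) ⟩
    2 ^ ⌈log₂ n ⌉           ∎
    where
    open ≤-Reasoning
    2≤n : 2 ≤ n
    2≤n = s≤s (s≤s z≤n)
    n≤2⌈n/2⌉ : n ≤ 2 * ⌈ n /2⌉
    n≤2⌈n/2⌉ = subst₂ _≤_ (⌊n/2⌋+⌈n/2⌉≡n n) (cong (⌈ n /2⌉ +_) (sym (+-identityʳ ⌈ n /2⌉)))
      (+-monoˡ-≤ ⌈ n /2⌉ (⌊n/2⌋≤⌈n/2⌉ n))

n^e<2^[f*3⌈log₂n⌉] : ∀ {e f} → 2 ≤ n → e < 3 * f → n ^ e < 2 ^ (f * (3 * ⌈log₂ n ⌉))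
n^e<2^[f*3⌈log₂n⌉] {n} {e} {f} 2≤n e<3f = begin-strict
  n ^ e             ≤⟨ ^-monoˡ-≤ e (n≤2^⌈log₂n⌉ n) ⟩
  (2 ^ L) ^ e       ≡⟨ ^-*-assoc 2 L e ⟩
  2 ^ (L * e)       <⟨ ^-monoʳ-< 2 (s≤s (s≤s z≤n)) (*-monoʳ-< L {{>-nonZero (0<⌈log₂n⌉ 2≤n)}} e<3f) ⟩
  2 ^ (L * (3 * f)) ≡⟨ cong (2 ^_) (rearrange L f) ⟩
  2 ^ (f * (3 * L)) ∎
  where
  open ≤-Reasoning
  L = ⌈log₂ n ⌉
  rearrange : ∀ L f → L * (3 * f) ≡ f * (3 * L)
  rearrange = solve-∀

codeCount<colouringCount : ∀ {k a m s} .{{_ : NonZero a}} → s ≤ n →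
  n ^ (k + s) * k ^ (s * m) < a ^ (s * m) →
  n ^ k * (n ^ s * (k ^ s * a ^ (n ∸ s)) ^ m) < (a ^ n) ^ m
codeCount<colouringCount {n} {k} {a} {m} {s} s≤n fewer = begin-strict
  n ^ k * (n ^ s * (k ^ s * a ^ (n ∸ s)) ^ m)
    ≡⟨ *-assoc (n ^ k) (n ^ s) _ ⟨
  n ^ k * n ^ s * (k ^ s * a ^ (n ∸ s)) ^ m
    ≡⟨ cong₂ _*_ (sym (^-distribˡ-+-* n k s)) ([m*n]^o≡m^o*n^o (k ^ s) (a ^ (n ∸ s)) m) ⟩
  n ^ (k + s) * ((k ^ s) ^ m * (a ^ (n ∸ s)) ^ m)
    ≡⟨ cong (n ^ (k + s) *_) (cong₂ _*_ (^-*-assoc k s m) (^-*-assoc a (n ∸ s) m)) ⟩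
  n ^ (k + s) * (k ^ (s * m) * a ^ ((n ∸ s) * m))
    ≡⟨ *-assoc (n ^ (k + s)) _ _ ⟨
  n ^ (k + s) * k ^ (s * m) * a ^ ((n ∸ s) * m)
    <⟨ *-monoˡ-< (a ^ ((n ∸ s) * m)) {{m^n≢0 a ((n ∸ s) * m)}} fewer ⟩
  a ^ (s * m) * a ^ ((n ∸ s) * m)
    ≡⟨ ^-distribˡ-+-* a (s * m) _ ⟨
  a ^ (s * m + (n ∸ s) * m)
    ≡⟨ cong (a ^_) (*-distribʳ-+ m s (n ∸ s)) ⟨
  a ^ ((s + (n ∸ s)) * m)
    ≡⟨ cong (λ t → a ^ (t * m)) (m+[n∸m]≡n s≤n) ⟩
  a ^ (n * m)
    ≡⟨ ^-*-assoc a n m ⟨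
  (a ^ n) ^ m ∎
  where open ≤-Reasoning

-- Colourings and covered points

Colouring : (m n a : ℕ) → Set
Colouring m n a = Vec (Vec (Fin a) n) m

module _ {m n a : ℕ} where

  colour : Colouring m n a → Fin m → Fin n → Fin a
  colour W r x = lookup (lookup W r) x

  InPalette : Colouring m n a → Subset n → Fin m → Fin a → Set
  InPalette W I r c = ∃[ i ] (i ∈ I × colour W r i ≡ c)

  inPalette? : (W : Colouring m n a) (I : Subset n) (r : Fin m) (c : Fin a) → Dec (InPalette W I r c)
  inPalette? W I r c = any? λ i → (i ∈? I) ×-dec (colour W r i Fin.≟ c)

  Covered : Colouring m n a → Subset n → Pred (Fin n) _
  Covered W I x = ∀ r → InPalette W I r (colour W r x)

  covered? : (W : Colouring m n a) (I : Subset n) → Decidable (Covered W I)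
  covered? W I x = all? λ r → inPalette? W I r (colour W r x)

  covered : Colouring m n a → Subset n → Subset n
  covered W I = subsetOf (covered? W I)

  ⊆-covered : (W : Colouring m n a) (I : Subset n) → I ⊆ covered W I
  ⊆-covered W I {x} x∈I = Equivalence.from (∈-subsetOf (covered? W I)) λ _ → x , x∈I , refl

-- Counting colourings in which some k-set covers k + s points

module Counting {n k a m s : ℕ} .{{_ : NonZero a}} where

  RowCode : Set
  RowCode = Vec (Fin k ⊎ Fin a) n

  Code : Set
  Code = Vec (Fin n) k × Vec RowCode m

  -- inj₁ is sent to an arbitrary colour; decoding an encoded colouring never reaches that case.
  plain : Fin k ⊎ Fin a → Fin a
  plain = [ const (fromℕ< (>-nonZero⁻¹ a)) , id ]

  decodeEntry : Vec (Fin n) k → RowCode → Fin k ⊎ Fin a → Fin a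
  decodeEntry is c = [ (λ j → plain (lookup c (lookup is j))) , id ]

  decodeRow : Vec (Fin n) k → RowCode → Vec (Fin a) n
  decodeRow is c = Vec.map (decodeEntry is c) c

  decode : Code → Colouring m n a
  decode (is , rows) = Vec.map (decodeRow is) rows

  slot : Side → List (Fin k ⊎ Fin a)
  slot inside  = map inj₁ (allFin k)
  slot outside = map inj₂ (allFin a)

  rowCodes : ∀ {t} → Subset t → List (Vec (Fin k ⊎ Fin a) t)
  rowCodes X = choices (Vec.map slot X)

  codes : List Code
  codes = cartesianProduct (vectors k (allFin n)) (concatMap (vectors m ∘ rowCodes) (subsetsOfSize n s))

  colourings : List (Colouring m n a)
  colourings = vectors m (vectors n (allFin a))

  -- is lists I; in row r, each x ∈ X is coded as inj₁ j, where the j-th listed member of I has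
  -- the colour of x, and every other point as inj₂ of its colour.
  module Encoding (W : Colouring m n a) {I X : Subset n}
                  (is : Vec (Fin n) k) (is-onto : ∀ {i} → i ∈ I → ∃[ j ] lookup is j ≡ i)
                  (X⊆covered─I : X ⊆ covered W I ─ I) where

    indexing : ∀ {x} → x ∈ X → ∀ r →
               Σ[ j ∈ Fin k ] (lookup is j ∈ I × colour W r (lookup is j) ≡ colour W r x)
    indexing x∈X r
      with i , i∈I , same ← Equivalence.to (∈-subsetOf (covered? W I)) (p─q⊆p _ I (X⊆covered─I x∈X)) r
      with j , refl ← is-onto i∈I = j , i∈I , same

    entry : Fin m → Fin n → Fin k ⊎ Fin a
    entry r x with x ∈? X
    ... | yes x∈X = inj₁ (proj₁ (indexing x∈X r))
    ... | no  _   = inj₂ (colour W r x)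

    code : Code
    code = is , tabulate (tabulate ∘ entry)

    entry-∈ : ∀ r {i} → i ∈ I → entry r i ≡ inj₂ (colour W r i)
    entry-∈ r {i} i∈I with i ∈? X
    ... | yes i∈X = ⊥-elim (x∈p─q⇒x∉q (X⊆covered─I i∈X) i∈I)
    ... | no  _   = refl

    decodeEntry-entry : ∀ r x → decodeEntry is (tabulate (entry r)) (entry r x) ≡ colour W r x
    decodeEntry-entry r x with x ∈? X
    ... | no  _   = refl
    ... | yes x∈X with j , j∈I , same ← indexing x∈X r = begin
      plain (lookup (tabulate (entry r)) (lookup is j))
        ≡⟨ cong plain (lookup∘tabulate (entry r) (lookup is j)) ⟩
      plain (entry r (lookup is j))
        ≡⟨ cong plain (entry-∈ r j∈I) ⟩
      colour W r (lookup is j)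
        ≡⟨ same ⟩
      colour W r x ∎
      where open ≡-Reasoning

    decode-code : decode code ≡ W
    decode-code = Pointwise-≡⇒≡ (ext λ r → begin
      lookup (decode code) r
        ≡⟨ lookup-map r (decodeRow is) (tabulate (tabulate ∘ entry)) ⟩
      decodeRow is (lookup (tabulate (tabulate ∘ entry)) r)
        ≡⟨ cong (decodeRow is) (lookup∘tabulate (tabulate ∘ entry) r) ⟩
      decodeRow is (tabulate (entry r))
        ≡⟨ Pointwise-≡⇒≡ (ext (decodeRow-entry r)) ⟩
      lookup W r ∎)
      where
      open ≡-Reasoning
      decodeRow-entry : ∀ r x → lookup (decodeRow is (tabulate (entry r))) x ≡ colour W r x
      decodeRow-entry r x = begin
        lookup (Vec.map (decodeEntry is (tabulate (entry r))) (tabulate (entry r))) x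
          ≡⟨ lookup-map x _ (tabulate (entry r)) ⟩
        decodeEntry is (tabulate (entry r)) (lookup (tabulate (entry r)) x)
          ≡⟨ cong (decodeEntry is (tabulate (entry r))) (lookup∘tabulate (entry r) x) ⟩
        decodeEntry is (tabulate (entry r)) (entry r x)
          ≡⟨ decodeEntry-entry r x ⟩
        colour W r x ∎

    entry∈slot : ∀ r x → entry r x ∈ₗ slot (lookup X x)
    entry∈slot r x with x ∈? X
    ... | yes x∈X rewrite []=⇒lookup x∈X         = ∈-map⁺ inj₁ (∈-allFin _)
    ... | no  x∉X rewrite x∉p⇒p[x]≡outside x∉X = ∈-map⁺ inj₂ (∈-allFin _)

    code∈codes : ∣ X ∣ ≡ s → code ∈ₗ codes
    code∈codes ∣X∣≡s = ∈-cartesianProduct⁺ (∈-vectors λ _ → ∈-allFin _)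
      (∈-concat⁺′ (∈-vectors rows∈) (∈-map⁺ (vectors m ∘ rowCodes) X∈))
      where
      X∈ : X ∈ₗ subsetsOfSize n s
      X∈ = subst (λ t → X ∈ₗ subsetsOfSize n t) ∣X∣≡s (∈-subsetsOfSize X)
      row∈ : ∀ r → tabulate (entry r) ∈ₗ rowCodes X
      row∈ r = ∈-choices {xss = Vec.map slot X} λ x →
        subst₂ _∈ₗ_ (sym (lookup∘tabulate (entry r) x)) (sym (lookup-map x slot X)) (entry∈slot r x)
      rows∈ : ∀ r → lookup (tabulate (tabulate ∘ entry)) r ∈ₗ rowCodes X
      rows∈ r = subst (_∈ₗ rowCodes X) (sym (lookup∘tabulate (tabulate ∘ entry) r)) (row∈ r)

  Bad : Colouring m n a → Set
  Bad W = ∃[ I ] (∣ I ∣ ≡ k × k + s ≤ ∣ covered W I ∣)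

  bad? : Decidable Bad
  bad? W = anySubset? λ I → (∣ I ∣ ≟ k) ×-dec (k + s ≤? ∣ covered W I ∣)

  bad⇒decoded : ∀ {W} → Bad W → W ∈ₗ map decode codes
  bad⇒decoded {W} (I , ∣I∣≡k , k+s≤∣I′∣)
    with is , is-onto ← enumeration I ∣I∣≡k
       | X , X⊆I′─I , ∣X∣≡s ← ⊆-ofSize (covered W I ─ I) (s≤∣p─q∣ (covered W I) I ∣I∣≡k k+s≤∣I′∣) =
    subst (_∈ₗ map decode codes) decode-code (∈-map⁺ decode (code∈codes ∣X∣≡s))
    where open Encoding W is is-onto X⊆I′─I

  length-rowCodes : ∀ {t} (X : Subset t) → length (rowCodes X) ≡ k ^ ∣ X ∣ * a ^ ∣ ∁ X ∣
  length-rowCodes []            = refl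
  length-rowCodes (inside ∷ X)  = begin
    length (rowCodes (inside ∷ X))
      ≡⟨ length-cartesianProductWith _∷_ (map inj₁ (allFin k)) (rowCodes X) ⟩
    length (map inj₁ (allFin k)) * length (rowCodes X)
      ≡⟨ cong₂ _*_ (length-map-allFin {A = Fin k ⊎ Fin a} inj₁) (length-rowCodes X) ⟩
    k * (k ^ ∣ X ∣ * a ^ ∣ ∁ X ∣)
      ≡⟨ *-assoc k _ _ ⟨
    k ^ suc ∣ X ∣ * a ^ ∣ ∁ X ∣ ∎
    where open ≡-Reasoning
  length-rowCodes (outside ∷ X) = begin
    length (rowCodes (outside ∷ X))
      ≡⟨ length-cartesianProductWith _∷_ (map inj₂ (allFin a)) (rowCodes X) ⟩
    length (map inj₂ (allFin a)) * length (rowCodes X)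
      ≡⟨ cong₂ _*_ (length-map-allFin {A = Fin k ⊎ Fin a} inj₂) (length-rowCodes X) ⟩
    a * (k ^ ∣ X ∣ * a ^ ∣ ∁ X ∣)
      ≡⟨ x∙yz≈y∙xz a (k ^ ∣ X ∣) (a ^ ∣ ∁ X ∣) ⟩
    k ^ ∣ X ∣ * a ^ suc ∣ ∁ X ∣ ∎
    where open ≡-Reasoning

  length-codes : length codes ≤ n ^ k * (n ^ s * (k ^ s * a ^ (n ∸ s)) ^ m)
  length-codes = begin
    length codes
      ≡⟨ length-cartesianProductWith _,_ (vectors k (allFin n)) _ ⟩
    length (vectors k (allFin n)) * length (concatMap (vectors m ∘ rowCodes) (subsetsOfSize n s))
      ≡⟨ cong₂ _*_ (trans (length-vectors k (allFin n)) (cong (_^ k) (length-tabulate id)))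
                   (length-concatMap-const (vectors m ∘ rowCodes) (subsetsOfSize n s) length-rows) ⟩
    n ^ k * (length (subsetsOfSize n s) * (k ^ s * a ^ (n ∸ s)) ^ m)
      ≤⟨ *-monoʳ-≤ (n ^ k) (*-monoˡ-≤ _ (length-subsetsOfSize n s)) ⟩
    n ^ k * (n ^ s * (k ^ s * a ^ (n ∸ s)) ^ m) ∎
    where
    open ≤-Reasoning
    length-rows : ∀ {X} → X ∈ₗ subsetsOfSize n s →
                  length (vectors m (rowCodes X)) ≡ (k ^ s * a ^ (n ∸ s)) ^ m
    length-rows {X} X∈ with refl ← ∈-subsetsOfSize⁻ X∈ = begin-equality
      length (vectors m (rowCodes X))   ≡⟨ length-vectors m (rowCodes X) ⟩
      length (rowCodes X) ^ m           ≡⟨ cong (_^ m) (length-rowCodes X) ⟩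
      (k ^ ∣ X ∣ * a ^ ∣ ∁ X ∣) ^ m     ≡⟨ cong (λ t → (k ^ ∣ X ∣ * a ^ t) ^ m) (∣∁p∣≡n∸∣p∣ X) ⟩
      (k ^ ∣ X ∣ * a ^ (n ∸ ∣ X ∣)) ^ m ∎

  length-colourings : length colourings ≡ (a ^ n) ^ m
  length-colourings = trans (length-vectors m (vectors n (allFin a)))
    (cong (_^ m) (trans (length-vectors n (allFin a)) (cong (_^ n) (length-tabulate id))))

  codes<colourings : s ≤ n → n ^ (k + s) * k ^ (s * m) < a ^ (s * m) → length codes < length colourings
  codes<colourings s≤n fewer = begin-strict
    length codes                                ≤⟨ length-codes ⟩
    n ^ k * (n ^ s * (k ^ s * a ^ (n ∸ s)) ^ m) <⟨ codeCount<colouringCount {n} {k} {a} {m} {s} s≤n fewer ⟩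
    (a ^ n) ^ m                                 ≡⟨ length-colourings ⟨
    length colourings                           ∎
    where open ≤-Reasoning

  goodColouring : length codes < length colourings →
                  ∃[ W ] (∀ I → ∣ I ∣ ≡ k → ∣ covered W I ∣ < k + s)
  goodColouring codes<colourings with Any.any? (¬? ∘ bad?) colourings
  ... | yes ∃good with W , ¬bad ← Any.satisfied ∃good =
    W , λ I ∣I∣≡k → ≰⇒> (¬bad ∘ (I ,_) ∘ (∣I∣≡k ,_))
  ... | no ∄good = contradiction codes<colourings (≤⇒≯ (begin
    length colourings
      ≤⟨ Unique-⊆⇒length≤ (Unique-vectors m (Unique-vectors n (Unique.allFin⁺ a))) all-bad ⟩
    length (map decode codes)
      ≡⟨ length-map decode codes ⟩
    length codes ∎))
    where
    open ≤-Reasoning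
    all-bad : colourings ⊆ₗ map decode codes
    all-bad {W} W∈ = bad⇒decoded (decidable-stable (bad? W) (All.lookup (¬Any⇒All¬ colourings ∄good) W∈))

-- The ℓ∞ embedding

‖x‖∞≤r⇔∀∣xⱼ∣≤r : ∀ {d} {r : ℚ} → 0ℚ Q.≤ r → (x : Point d) → (‖ x ‖∞ Q.≤ r) ⇔ (∀ j → Q.∣ x j ∣ Q.≤ r)
‖x‖∞≤r⇔∀∣xⱼ∣≤r {zero}  0≤r x = mk⇔ (λ _ ()) (λ _ → 0≤r)
‖x‖∞≤r⇔∀∣xⱼ∣≤r {suc d} 0≤r x = mk⇔ to from
  where
  tail⇔ = ‖x‖∞≤r⇔∀∣xⱼ∣≤r 0≤r (x ∘ suc)
  to : ‖ x ‖∞ Q.≤ _ → ∀ j → Q.∣ x j ∣ Q.≤ _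
  to ‖x‖≤r zero    = ℚₚ.≤-trans (ℚₚ.p≤p⊔q _ _) ‖x‖≤r
  to ‖x‖≤r (suc j) = Equivalence.to tail⇔ (ℚₚ.≤-trans (ℚₚ.p≤q⊔p Q.∣ x zero ∣ _) ‖x‖≤r) j
  from : (∀ j → Q.∣ x j ∣ Q.≤ _) → ‖ x ‖∞ Q.≤ _
  from ∣x∣≤r = ℚₚ.⊔-lub (∣x∣≤r zero) (Equivalence.from tail⇔ (∣x∣≤r ∘ suc))

∣𝟙-½𝟙∣≤½⇔ : ∀ {p r} {P : Set p} {R : Set r} (P? : Dec P) (R? : Dec R) →
  (Q.∣ (if does P? then 1ℚ else 0ℚ) - (if does R? then ½ else 0ℚ) ∣ Q.≤ ½) ⇔ (P → R)
∣𝟙-½𝟙∣≤½⇔ (yes _) (yes r) = mk⇔ (λ _ _ → r) (λ _ → toWitness {a? = Q.∣ 1ℚ - ½ ∣ Q.≤? ½} _)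
∣𝟙-½𝟙∣≤½⇔ (yes p) (no ¬r) =
  mk⇔ (⊥-elim ∘ toWitnessFalse {a? = Q.∣ 1ℚ - 0ℚ ∣ Q.≤? ½} _) (λ P⇒R → ⊥-elim (¬r (P⇒R p)))
∣𝟙-½𝟙∣≤½⇔ (no ¬p) (yes _) = mk⇔ (λ _ → ⊥-elim ∘ ¬p) (λ _ → toWitness {a? = Q.∣ 0ℚ - ½ ∣ Q.≤? ½} _)
∣𝟙-½𝟙∣≤½⇔ (no ¬p) (no _)  = mk⇔ (λ _ → ⊥-elim ∘ ¬p) (λ _ → toWitness {a? = Q.∣ 0ℚ - 0ℚ ∣ Q.≤? ½} _)

∀-remQuot⇔ : ∀ {m a} {P : Fin m × Fin a → Set ℓ} → (∀ j → P (remQuot a j)) ⇔ (∀ r c → P (r , c))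
∀-remQuot⇔ {P = P} =
  mk⇔ (λ ∀j r c → subst P (remQuot-combine r c) (∀j (combine r c))) (λ ∀rc j → ∀rc _ _)

Selector : (n k d : ℕ) → Set
Selector n k d = Σ (Fin n → Point d) λ p →
  (I : Subset n) → ∣ I ∣ ≡ k → Σ (Point d) λ q → ∃[ I′ ]
    ((∀ i → (i ∈ I′) ⇔ (‖ p i -ᵥ q ‖∞ Q.≤ ½)) × I ⊆ I′ × 2 * ∣ I′ ∣ ≤ 3 * k)

trivialSelector : ∀ {k} → 2 * n ≤ 3 * k → Selector n k 0
trivialSelector {n} 2n≤3k = (λ _ ()) , λ _ _ → (λ ()) , ⊤ ,
  (λ _ → mk⇔ (λ _ → toWitness {a? = 0ℚ Q.≤? ½} _) (λ _ → ∈⊤)) , (λ _ → ∈⊤) ,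
  subst (λ t → 2 * t ≤ _) (sym (∣⊤∣≡n n)) 2n≤3k

module _ {m n a : ℕ} (W : Colouring m n a) where

  incidence : Fin n → Fin m × Fin a → ℚ
  incidence x (r , c) = if does (colour W r x Fin.≟ c) then 1ℚ else 0ℚ

  paletteIndicator : Subset n → Fin m × Fin a → ℚ
  paletteIndicator I (r , c) = if does (inPalette? W I r c) then ½ else 0ℚ

  point : Fin n → Point (m * a)
  point x = incidence x ∘ remQuot a

  query : Subset n → Point (m * a)
  query I = paletteIndicator I ∘ remQuot a

  near⇔Covered : ∀ I x → (‖ point x -ᵥ query I ‖∞ Q.≤ ½) ⇔ Covered W I x
  near⇔Covered I x = mk⇔ to from
    where
    coordinatewise = ⇔.trans (‖x‖∞≤r⇔∀∣xⱼ∣≤r (toWitness {a? = 0ℚ Q.≤? ½} _) (point x -ᵥ query I))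
                             (∀-remQuot⇔ {P = λ rc → Q.∣ incidence x rc - paletteIndicator I rc ∣ Q.≤ ½})
    to : ‖ point x -ᵥ query I ‖∞ Q.≤ ½ → Covered W I x
    to near r =
      Equivalence.to (∣𝟙-½𝟙∣≤½⇔ (colour W r x Fin.≟ colour W r x) (inPalette? W I r (colour W r x)))
                     (Equivalence.to coordinatewise near r (colour W r x)) refl
    from : Covered W I x → ‖ point x -ᵥ query I ‖∞ Q.≤ ½
    from cov = Equivalence.from coordinatewise λ r c →
      Equivalence.from (∣𝟙-½𝟙∣≤½⇔ (colour W r x Fin.≟ c) (inPalette? W I r c)) λ { refl → cov r }

  selectorOf : ∀ {k} → (∀ I → ∣ I ∣ ≡ k → 2 * ∣ covered W I ∣ ≤ 3 * k) → Selector n k (m * a)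
  selectorOf small = point , λ I ∣I∣≡k → query I , covered W I ,
    (λ x → ⇔.trans (∈-subsetOf (covered? W I)) (⇔.sym (near⇔Covered I x))) , ⊆-covered W I , small I ∣I∣≡k

colouringSelector : ∀ {k} → 0 < k → k + ⌊ k /2⌋ < n → Selector n k (3 * ⌈log₂ n ⌉ * (2 * k))
colouringSelector {n} {k@(suc _)} _ k+t<n = selectorOf (proj₁ good) small
  where
  t = ⌊ k /2⌋
  s = suc t
  m = 3 * ⌈log₂ n ⌉
  open Counting {n} {k} {2 * k} {m} {s}
  k+s<3s : k + s < 3 * s
  k+s<3s = ≤-trans (s≤s (+-monoˡ-≤ s (k≤1+⌊k/2⌋+⌊k/2⌋ k))) (≤-reflexive (rearrange t))
    where
    rearrange : ∀ t → suc (suc (t + t) + suc t) ≡ 3 * suc t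
    rearrange = solve-∀
  2≤n : 2 ≤ n
  2≤n = ≤-trans (s≤s (s≤s z≤n)) k+t<n
  fewer : n ^ (k + s) * k ^ (s * m) < (2 * k) ^ (s * m)
  fewer = begin-strict
    n ^ (k + s) * k ^ (s * m)
      <⟨ *-monoˡ-< (k ^ (s * m)) {{m^n≢0 k (s * m)}} (n^e<2^[f*3⌈log₂n⌉] {n} {k + s} {s} 2≤n k+s<3s) ⟩
    2 ^ (s * m) * k ^ (s * m)
      ≡⟨ [m*n]^o≡m^o*n^o 2 k (s * m) ⟨
    (2 * k) ^ (s * m) ∎
    where open ≤-Reasoning
  good : ∃[ W ] (∀ I → ∣ I ∣ ≡ k → ∣ covered W I ∣ < k + s)
  good = goodColouring (codes<colourings (≤-trans (s≤s (m≤n+m t k)) k+t<n) fewer)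
  small : ∀ I → ∣ I ∣ ≡ k → 2 * ∣ covered (proj₁ good) I ∣ ≤ 3 * k
  small I ∣I∣≡k =
    x≤k+⌊k/2⌋⇒2x≤3k k (≤-pred (subst (∣ covered (proj₁ good) I ∣ <_) (+-suc k t) (proj₂ good I ∣I∣≡k)))

mainTheorem9 : ∃[ C ] ((n k : ℕ) → 0 < k → k ≤ n →
    ∃[ d ] (d ≤ C * k * ⌈log₂ n ⌉ ×
      Σ (Fin n → Point d) λ p →
        (I : Subset n) → ∣ I ∣ ≡ k → Σ (Point d) λ q → ∃[ I′ ]
          ((∀ i → (i ∈ I′) ⇔ (‖ p i -ᵥ q ‖∞ Q.≤ ½)) × I ⊆ I′ × 2 * ∣ I′ ∣ ≤ 3 * k)))
mainTheorem9 = 6 , λ n k 0<k _ → selector n k 0<k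
  where
  selector : ∀ n k → 0 < k → ∃[ d ] (d ≤ 6 * k * ⌈log₂ n ⌉ × Selector n k d)
  selector n k 0<k with n ≤? k + ⌊ k /2⌋
  ... | yes n≤k+k/2 = 0 , z≤n , trivialSelector (x≤k+⌊k/2⌋⇒2x≤3k k n≤k+k/2)
  ... | no  n≰k+k/2 =
    3 * ⌈log₂ n ⌉ * (2 * k) , ≤-reflexive (rearrange ⌈log₂ n ⌉ k) , colouringSelector 0<k (≰⇒> n≰k+k/2)
    where
    rearrange : ∀ L k → 3 * L * (2 * k) ≡ 6 * k * L
    rearrange = solve-∀
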